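{- Let $f(n)=\sum_{j=0}^{n}(-1)^{j}S(n,j)$. For all integers $n\ge 0$ and $h\ge 1$, $$f(n)\equiv f\bigl(n+3\cdot 4^{h-1}\bigr)\pmod{2^h}.$$
   Context: $S(n,k)$ denotes the Stirling number of the second kind (number of partitions of an $n$-element set into $k$ nonempty blocks, $S(0,0)=1$). -}

module Defs where

open import Data.Nat using (ℕ; zero; suc; _+_; _*_)
open import Data.Integer using (ℤ; +_; -_)
import Data.Integer as ℤ

S : ℕ → ℕ → ℕ
S zero    zero    = 1
S zero    (suc k) = 0
S (suc n) zero    = 0
S (suc n) (suc k) = suc k * S n (suc k) + S n k

sgn : ℕ → ℤ
sgn zero    = + 1
sgn (suc j) = - sgn j

sumTo : ℕ → (ℕ → ℤ) → ℤ
sumTo zero    g = g 0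
sumTo (suc m) g = sumTo m g ℤ.+ g (suc m)

f : ℕ → ℤ
f n = sumTo n (λ j → sgn j ℤ.* (+ S n j))

{-# OPTIONS --safe #-}
-- Let φ be the linear functional on ℤ[x] with φ(x(x−1)⋯(x−j+1)) = (−1)^j.  Since
-- x^n = Σ_j S(n,j) x(x−1)⋯(x−j+1), we have f(n) = φ(x^n).  As (−1)^j has period 2, multiplying
-- by the falling factorial (x)_K of an even length K changes φ only by a multiple of K; for
-- K = 2^(h+1) this says that the sequence f is fixed modulo 2^(h+1) by multiplication with
-- (x)_K.  Modulo 2, (x)_K ≡ (x² − x)^(K/2) ≡ x^K − x^(K/2) as K/2 is a power of 2, and a
-- sequence fixed modulo 2 by x^(2t) − x^t has period 3t modulo 2, because
-- x^(3t) − 1 = (x^t − 1)(x^(2t) + x^t + 1).  Finally the period lifts: if a is fixed modulo 2P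
-- and a(n + s) − a(n) = P c(n) with s a multiple of 3K/2, then c is fixed modulo 2, hence
-- c(n + s) ≡ c(n) modulo 2, and a(n + 2s) − a(n) = P (c(n + s) + c(n)) is divisible by 2P.
module Submission where

open import Defs
open import Data.Nat using (ℕ; zero; suc; _+_; _*_; _^_; _<_; s≤s; NonZero)
import Data.Nat.Properties as ℕₚ
open import Data.Nat.Divisibility using (n∣m*n)
open import Data.Nat.GeneralisedArithmetic using (fold; fold-+)
open import Data.Nat.Tactic.RingSolver using () renaming (solve-∀ to ℕ-solve-∀)
open import Data.Integer using (ℤ; +_; -_; _-_; 0ℤ)
import Data.Integer as ℤ
import Data.Integer.Properties as ℤₚ
open import Data.Integer.Divisibility using (_∣_)
import Data.Integer.Divisibility.Signed as Signed
open import Data.Integer.Tactic.RingSolver using (solve-∀)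
open import Level using (0ℓ)
open import Relation.Binary.Bundles using (Setoid)
import Relation.Binary.Reasoning.Setoid as ≈-Reasoning
open import Relation.Binary.PropositionalEquality

infix 4 _≡_mod_ _≈_mod_

-- A record rather than a synonym for divisibility, so that x and y can be inferred.
record _≡_mod_ (x y : ℤ) (m : ℕ) : Set where
  constructor mod⇐∣
  field mod⇒∣ : + m Signed.∣ x - y
open _≡_mod_

Seq : Set
Seq = ℕ → ℤ

_≈_mod_ : Seq → Seq → ℕ → Set
a ≈ b mod m = ∀ n → a n ≡ b n mod m

variable
  m : ℕ
  x y z u v : ℤ
  a b : Seq

mod⇐∣-rearranged : z ≡ x - y → + m Signed.∣ z → x ≡ y mod m
mod⇐∣-rearranged refl = mod⇐∣

≡⇒≡-mod : x ≡ y → x ≡ y mod m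
≡⇒≡-mod {x = x} refl = mod⇐∣-rearranged (sym (ℤₚ.+-inverseʳ x)) (Signed.divides 0ℤ refl)

mod-sym : x ≡ y mod m → y ≡ x mod m
mod-sym {x = x} {y} (mod⇐∣ p) = mod⇐∣-rearranged (negate x y) (Signed.∣m⇒∣-m p)
  where
  negate : ∀ x y → - (x - y) ≡ y - x
  negate = solve-∀

mod-trans : x ≡ y mod m → y ≡ z mod m → x ≡ z mod m
mod-trans {x = x} {y} {z = z} (mod⇐∣ p) (mod⇐∣ q) =
  mod⇐∣-rearranged (ℤₚ.+-minus-telescope x y z) (Signed.∣m∣n⇒∣m+n p q)

mod-setoid : ℕ → Setoid 0ℓ 0ℓ
mod-setoid m = record
  { Carrier       = ℤ
  ; _≈_           = λ x y → x ≡ y mod m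
  ; isEquivalence = record { refl = ≡⇒≡-mod refl ; sym = mod-sym ; trans = mod-trans }
  }

mod-+ : x ≡ y mod m → u ≡ v mod m → x ℤ.+ u ≡ y ℤ.+ v mod m
mod-+ {x = x} {y} {u = u} {v} (mod⇐∣ p) (mod⇐∣ q) =
  mod⇐∣-rearranged (regroup x y u v) (Signed.∣m∣n⇒∣m+n p q)
  where
  regroup : ∀ x y u v → (x - y) ℤ.+ (u - v) ≡ (x ℤ.+ u) - (y ℤ.+ v)
  regroup = solve-∀

mod-- : x ≡ y mod m → u ≡ v mod m → x - u ≡ y - v mod m
mod-- {x = x} {y} {u = u} {v} (mod⇐∣ p) (mod⇐∣ q) =
  mod⇐∣-rearranged (regroup x y u v) (Signed.∣m∣n⇒∣m-n p q)
  where
  regroup : ∀ x y u v → (x - y) - (u - v) ≡ (x - u) - (y - v)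
  regroup = solve-∀

mod-* : x ≡ y mod m → u ≡ v mod m → x ℤ.* u ≡ y ℤ.* v mod m
mod-* {x = x} {y} {u = u} {v} (mod⇐∣ p) (mod⇐∣ q) =
  mod⇐∣-rearranged (regroup x y u v)
    (Signed.∣m∣n⇒∣m+n (Signed.∣m⇒∣m*n u p) (Signed.∣n⇒∣m*n y q))
  where
  regroup : ∀ x y u v → (x - y) ℤ.* u ℤ.+ y ℤ.* (u - v) ≡ x ℤ.* u - y ℤ.* v
  regroup = solve-∀

+-multiple-mod : ∀ k m → + (k + m) ≡ + k mod m
+-multiple-mod k m =
  mod⇐∣-rearranged (sym (trans (cong (_- + k) (ℤₚ.pos-+ k m)) (cancel (+ k) (+ m)))) Signed.∣-refl
  where
  cancel : ∀ x y → x ℤ.+ y - x ≡ y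
  cancel = solve-∀

mod-weaken : ∀ k → x ≡ y mod k * m → x ≡ y mod m
mod-weaken k (mod⇐∣ p) = mod⇐∣ (Signed.∣-trans (Signed.∣ᵤ⇒∣ (n∣m*n k)) p)

mod-cancelʳ : ∀ k .{{_ : NonZero k}} → x ℤ.* + k ≡ y ℤ.* + k mod m * k → x ≡ y mod m
mod-cancelʳ {x = x} {y} {m} k (mod⇐∣ p) =
  mod⇐∣ (Signed.*-cancelʳ-∣ (+ k) (subst₂ Signed._∣_ (ℤₚ.pos-* m k) (factor x y (+ k)) p))
  where
  factor : ∀ x y k → x ℤ.* k - y ℤ.* k ≡ (x - y) ℤ.* k
  factor = solve-∀

-- A sequence a stands for the functional x^n ↦ a n on ℤ[x]: Δ k multiplies it by x − k,
-- falling k by x(x−1)⋯(x−k+1), and Q t by x^(2t) − x^t.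

Δ : ℕ → Seq → Seq
Δ k a n = a (suc n) - + k ℤ.* a n

falling : ℕ → Seq → Seq
falling zero    a = a
falling (suc k) a = Δ k (falling k a)

Q : ℕ → Seq → Seq
Q t a n = a (n + 2 * t) - a (n + t)

Q-cong-mod : ∀ t → a ≈ b mod m → Q t a ≈ Q t b mod m
Q-cong-mod t p n = mod-- (p (n + 2 * t)) (p (n + t))

falling-cong : ∀ k → a ≗ b → falling k a ≗ falling k b
falling-cong zero    e n = e n
falling-cong (suc k) e n = cong₂ (λ u v → u - + k ℤ.* v) (falling-cong k e (suc n)) (falling-cong k e n)

falling-shift : ∀ k s a → falling k (λ n → a (n + s)) ≗ (λ n → falling k a (n + s))
falling-shift zero    s a n = refl
falling-shift (suc k) s a n =
  cong₂ (λ u v → u - + k ℤ.* v) (falling-shift k s a (suc n)) (falling-shift k s a n)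

falling-sub : ∀ k a b → falling k (λ n → a n - b n) ≗ (λ n → falling k a n - falling k b n)
falling-sub zero    a b n = refl
falling-sub (suc k) a b n = trans
  (cong₂ (λ u v → u - + k ℤ.* v) (falling-sub k a b (suc n)) (falling-sub k a b n))
  (regroup (falling k a (suc n)) (falling k b (suc n)) (falling k a n) (falling k b n) (+ k))
  where
  regroup : ∀ w x y z k → (w - x) - k ℤ.* (y - z) ≡ (w - k ℤ.* y) - (x - k ℤ.* z)
  regroup = solve-∀

falling-scaleʳ : ∀ k a d → falling k (λ n → a n ℤ.* d) ≗ (λ n → falling k a n ℤ.* d)
falling-scaleʳ zero    a d n = refl
falling-scaleʳ (suc k) a d n = trans
  (cong₂ (λ u v → u - + k ℤ.* v) (falling-scaleʳ k a d (suc n)) (falling-scaleʳ k a d n))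
  (factor (falling k a (suc n)) (falling k a n) d (+ k))
  where
  factor : ∀ x y d k → x ℤ.* d - k ℤ.* (y ℤ.* d) ≡ (x - k ℤ.* y) ℤ.* d
  factor = solve-∀

Δ-pair : ∀ i a → Δ (suc (2 * i)) (Δ (2 * i) a) ≈ Q 1 a mod 2
Δ-pair i a n = mod⇐∣ (Signed.divides (I ℤ.* (+ 1 ℤ.+ + 2 ℤ.* I) ℤ.* Z - + 2 ℤ.* I ℤ.* Y) (begin
    (X - + (2 * i) ℤ.* Y) - + suc (2 * i) ℤ.* (Y - + (2 * i) ℤ.* Z) - (a (n + 2) - a (n + 1))
  ≡⟨ cong₂ (λ p q → (X - + (2 * i) ℤ.* Y) - + suc (2 * i) ℤ.* (Y - + (2 * i) ℤ.* Z) - (a p - a q))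
           (ℕₚ.+-comm n 2) (ℕₚ.+-comm n 1) ⟩
    (X - + (2 * i) ℤ.* Y) - (+ 1 ℤ.+ + (2 * i)) ℤ.* (Y - + (2 * i) ℤ.* Z) - (X - Y)
  ≡⟨ cong (λ K → (X - K ℤ.* Y) - (+ 1 ℤ.+ K) ℤ.* (Y - K ℤ.* Z) - (X - Y)) (ℤₚ.pos-* 2 i) ⟩
    (X - + 2 ℤ.* I ℤ.* Y) - (+ 1 ℤ.+ + 2 ℤ.* I) ℤ.* (Y - + 2 ℤ.* I ℤ.* Z) - (X - Y)
  ≡⟨ expand X Y Z I ⟩
    (I ℤ.* (+ 1 ℤ.+ + 2 ℤ.* I) ℤ.* Z - + 2 ℤ.* I ℤ.* Y) ℤ.* + 2 ∎))
  where
  open ≡-Reasoning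
  X = a (suc (suc n))
  Y = a (suc n)
  Z = a n
  I = + i
  expand : ∀ X Y Z I →
           (X - + 2 ℤ.* I ℤ.* Y) - (+ 1 ℤ.+ + 2 ℤ.* I) ℤ.* (Y - + 2 ℤ.* I ℤ.* Z) - (X - Y)
           ≡ (I ℤ.* (+ 1 ℤ.+ + 2 ℤ.* I) ℤ.* Z - + 2 ℤ.* I ℤ.* Y) ℤ.* + 2
  expand = solve-∀

Q-square : ∀ t a → Q t (Q t a) ≈ Q (2 * t) a mod 2
Q-square t a n = mod⇐∣ (Signed.divides (C - B) (begin
    (a (n + 2 * t + 2 * t) - a (n + 2 * t + t)) - (a (n + t + 2 * t) - a (n + t + t)) - (A - C)
  ≡⟨ cong₂ (λ p q → (a p - B) - (a q - a (n + t + t)) - (A - C)) (index₁ n t) (index₂ n t) ⟩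
    (A - B) - (B - a (n + t + t)) - (A - C)
  ≡⟨ cong (λ p → (A - B) - (B - a p) - (A - C)) (index₃ n t) ⟩
    (A - B) - (B - C) - (A - C)
  ≡⟨ square A B C ⟩
    (C - B) ℤ.* + 2 ∎))
  where
  open ≡-Reasoning
  A = a (n + 2 * (2 * t))
  B = a (n + 2 * t + t)
  C = a (n + 2 * t)
  index₁ : ∀ n t → n + 2 * t + 2 * t ≡ n + 2 * (2 * t)
  index₁ = ℕ-solve-∀
  index₂ : ∀ n t → n + t + 2 * t ≡ n + 2 * t + t
  index₂ = ℕ-solve-∀
  index₃ : ∀ n t → n + t + t ≡ n + 2 * t
  index₃ = ℕ-solve-∀
  square : ∀ A B C → (A - B) - (B - C) - (A - C) ≡ (C - B) ℤ.* + 2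
  square = solve-∀

Q-period : ∀ t c → Q t c ≈ c mod 2 → ∀ n → c (n + 3 * t) ≡ c n mod 2
Q-period t c fixed n = mod⇐∣-rearranged telescope
  (Signed.∣m∣n⇒∣m+n (Signed.∣m∣n⇒∣m+n (mod⇒∣ (fixed (n + t))) (mod⇒∣ (fixed n)))
                    (Signed.∣n⇒∣m*n Y Signed.∣-refl))
  where
  open ≡-Reasoning
  W = c (n + 3 * t)
  X = c (n + 2 * t)
  Y = c (n + t)
  Z = c n
  index₁ : ∀ n t → n + t + 2 * t ≡ n + 3 * t
  index₁ = ℕ-solve-∀
  index₂ : ∀ n t → n + t + t ≡ n + 2 * t
  index₂ = ℕ-solve-∀
  sum : ∀ W X Y Z → (W - X - Y) ℤ.+ (X - Y - Z) ℤ.+ Y ℤ.* + 2 ≡ W - Z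
  sum = solve-∀
  telescope : (c (n + t + 2 * t) - c (n + t + t) - Y) ℤ.+ (X - Y - Z) ℤ.+ Y ℤ.* + 2 ≡ W - Z
  telescope = begin
      (c (n + t + 2 * t) - c (n + t + t) - Y) ℤ.+ (X - Y - Z) ℤ.+ Y ℤ.* + 2
    ≡⟨ cong₂ (λ p q → (c p - c q - Y) ℤ.+ (X - Y - Z) ℤ.+ Y ℤ.* + 2) (index₁ n t) (index₂ n t) ⟩
      (W - X - Y) ℤ.+ (X - Y - Z) ℤ.+ Y ℤ.* + 2
    ≡⟨ sum W X Y Z ⟩
      W - Z ∎

falling-double : ∀ t a → falling (2 * t) a ≈ fold a (Q 1) t mod 2
falling-double zero    a n = ≡⇒≡-mod refl
falling-double (suc t) a n =
  subst (λ k → falling k a n ≡ fold a (Q 1) (suc t) n mod 2) (sym (ℕₚ.*-suc 2 t))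
        (mod-trans (Δ-pair t (falling (2 * t) a) n) (Q-cong-mod 1 (falling-double t a) n))

fold-Q-pow : ∀ h a → fold a (Q 1) (2 ^ h) ≈ Q (2 ^ h) a mod 2
fold-Q-pow zero    a n = ≡⇒≡-mod refl
fold-Q-pow (suc h) a n = begin
    fold a (Q 1) (2 ^ suc h) n        ≡⟨ cong (λ e → fold a (Q 1) (t + e) n) (ℕₚ.+-identityʳ t) ⟩
    fold a (Q 1) (t + t) n            ≡⟨ cong (λ b → b n) (fold-+ a (Q 1) t) ⟩
    fold (fold a (Q 1) t) (Q 1) t n   ≈⟨ fold-Q-pow h (fold a (Q 1) t) n ⟩
    Q t (fold a (Q 1) t) n            ≈⟨ Q-cong-mod t (fold-Q-pow h a) n ⟩
    Q t (Q t a) n                     ≈⟨ Q-square t a n ⟩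
    Q (2 ^ suc h) a n                 ∎
  where
  open ≈-Reasoning (mod-setoid 2)
  t = 2 ^ h

falling-period-mod-2 : ∀ h c → falling (2 ^ suc h) c ≈ c mod 2 →
                       ∀ n → c (n + 3 * 2 ^ h) ≡ c n mod 2
falling-period-mod-2 h c fixed = Q-period (2 ^ h) c λ n → begin
    Q (2 ^ h) c n             ≈⟨ fold-Q-pow h c n ⟨
    fold c (Q 1) (2 ^ h) n    ≈⟨ falling-double (2 ^ h) c n ⟨
    falling (2 ^ suc h) c n   ≈⟨ fixed n ⟩
    c n                       ∎
  where
  open ≈-Reasoning (mod-setoid 2)

period-multiple : ∀ {p} (c : Seq) → (∀ n → c (n + p) ≡ c n mod m) →
                  ∀ q n → c (n + q * p) ≡ c n mod m
period-multiple c periodic zero    n = ≡⇒≡-mod (cong c (ℕₚ.+-identityʳ n))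
period-multiple {m} {p} c periodic (suc q) n = begin
    c (n + (p + q * p))   ≡⟨ cong c (ℕₚ.+-assoc n p (q * p)) ⟨
    c (n + p + q * p)     ≈⟨ period-multiple c periodic q (n + p) ⟩
    c (n + p)             ≈⟨ periodic n ⟩
    c n                   ∎
  where
  open ≈-Reasoning (mod-setoid m)

falling-fixed-diff : ∀ k s → falling k a ≈ a mod m →
                     falling k (λ n → a (n + s) - a n) ≈ (λ n → a (n + s) - a n) mod m
falling-fixed-diff {a} {m} k s fixed n = begin
    falling k (λ i → a (i + s) - a i) n             ≡⟨ falling-sub k (λ i → a (i + s)) a n ⟩
    falling k (λ i → a (i + s)) n - falling k a n   ≡⟨ cong (_- falling k a n) (falling-shift k s a n) ⟩
    falling k a (n + s) - falling k a n             ≈⟨ mod-- (fixed (n + s)) (fixed n) ⟩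
    a (n + s) - a n                                 ∎
  where
  open ≈-Reasoning (mod-setoid m)

falling-fixed-quotient : ∀ k P .{{_ : NonZero P}} (c : Seq) → (∀ n → b n ≡ c n ℤ.* + P) →
                         falling k b ≈ b mod m * P → falling k c ≈ c mod m
falling-fixed-quotient {b} {m} k P c b≡cP fixed n = mod-cancelʳ P (begin
    falling k c n ℤ.* + P             ≡⟨ falling-scaleʳ k c (+ P) n ⟨
    falling k (λ i → c i ℤ.* + P) n   ≡⟨ falling-cong k b≡cP n ⟨
    falling k b n                     ≈⟨ fixed n ⟩
    b n                               ≡⟨ b≡cP n ⟩
    c n ℤ.* + P                       ∎)
  where
  open ≈-Reasoning (mod-setoid (m * P))

period-doubling : ∀ P s (a c : Seq) → (∀ n → a (n + s) - a n ≡ c n ℤ.* + P) →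
                  (∀ n → c (n + s) ≡ c n mod 2) → ∀ n → a (n + s + s) ≡ a n mod 2 * P
period-doubling P s a c a≡cP c-periodic n =
  mod⇐∣ (subst₂ Signed._∣_ (sym (ℤₚ.pos-* 2 P)) sum (Signed.*-monoˡ-∣ (+ P) even))
  where
  open ≡-Reasoning
  even : + 2 Signed.∣ c (n + s) - c n ℤ.+ c n ℤ.* + 2
  even = Signed.∣m∣n⇒∣m+n (mod⇒∣ (c-periodic n)) (Signed.∣n⇒∣m*n (c n) Signed.∣-refl)
  expand : ∀ x y P → (x - y ℤ.+ y ℤ.* + 2) ℤ.* P ≡ x ℤ.* P ℤ.+ y ℤ.* P
  expand = solve-∀
  sum : (c (n + s) - c n ℤ.+ c n ℤ.* + 2) ℤ.* + P ≡ a (n + s + s) - a n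
  sum = begin
      (c (n + s) - c n ℤ.+ c n ℤ.* + 2) ℤ.* + P
    ≡⟨ expand (c (n + s)) (c n) (+ P) ⟩
      c (n + s) ℤ.* + P ℤ.+ c n ℤ.* + P
    ≡⟨ cong₂ ℤ._+_ (a≡cP (n + s)) (a≡cP n) ⟨
      (a (n + s + s) - a (n + s)) ℤ.+ (a (n + s) - a n)
    ≡⟨ ℤₚ.+-minus-telescope (a (n + s + s)) (a (n + s)) (a n) ⟩
      a (n + s + s) - a n ∎

falling-period-lift : ∀ k p → (∀ c → falling k c ≈ c mod 2 → ∀ n → c (n + p) ≡ c n mod 2) →
                      ∀ j a → falling k a ≈ a mod 2 ^ suc j →
                      ∀ n → a (n + 2 ^ j * p) ≡ a n mod 2 ^ suc j
falling-period-lift k p detects zero a fixed n =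
  subst (λ e → a (n + e) ≡ a n mod 2) (sym (ℕₚ.+-identityʳ p)) (detects a fixed n)
falling-period-lift k p detects (suc j) a fixed n =
  subst (λ e → a e ≡ a n mod 2 ^ suc (suc j)) (sym (split-shift n (2 ^ j) p))
        (period-doubling P s a c a≡cP c-periodic n)
  where
  P = 2 ^ suc j
  s = 2 ^ j * p
  half : ∀ i → a (i + s) ≡ a i mod P
  half = falling-period-lift k p detects j a (λ i → mod-weaken 2 (fixed i))
  c : Seq
  c i = Signed.quotient (mod⇒∣ (half i))
  a≡cP : ∀ i → a (i + s) - a i ≡ c i ℤ.* + P
  a≡cP i = Signed._∣_.equality (mod⇒∣ (half i))
  c-fixed : falling k c ≈ c mod 2
  c-fixed = falling-fixed-quotient k P {{ℕₚ.m^n≢0 2 (suc j)}} c a≡cP (falling-fixed-diff k s fixed)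
  c-periodic : ∀ i → c (i + s) ≡ c i mod 2
  c-periodic = period-multiple c (detects c c-fixed) (2 ^ j)
  split-shift : ∀ n x p → n + 2 * x * p ≡ n + x * p + x * p
  split-shift = ℕ-solve-∀

sumTo-cong : ∀ n {g g′ : ℕ → ℤ} → g ≗ g′ → sumTo n g ≡ sumTo n g′
sumTo-cong zero    e = e 0
sumTo-cong (suc n) e = cong₂ ℤ._+_ (sumTo-cong n e) (e (suc n))

sumTo-+ : ∀ n (g g′ : ℕ → ℤ) → sumTo n (λ j → g j ℤ.+ g′ j) ≡ sumTo n g ℤ.+ sumTo n g′
sumTo-+ zero    g g′ = refl
sumTo-+ (suc n) g g′ =
  trans (cong (ℤ._+ (g (suc n) ℤ.+ g′ (suc n))) (sumTo-+ n g g′))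
        (interchange (sumTo n g) (sumTo n g′) (g (suc n)) (g′ (suc n)))
  where
  interchange : ∀ w x y z → w ℤ.+ x ℤ.+ (y ℤ.+ z) ≡ w ℤ.+ y ℤ.+ (x ℤ.+ z)
  interchange = solve-∀

sumTo-suc : ∀ n (g : ℕ → ℤ) → sumTo (suc n) g ≡ g 0 ℤ.+ sumTo n (λ j → g (suc j))
sumTo-suc zero    g = refl
sumTo-suc (suc n) g = trans (cong (ℤ._+ g (suc (suc n))) (sumTo-suc n g)) (ℤₚ.+-assoc (g 0) _ _)

sumTo-reindex : ∀ n (g : ℕ → ℤ) → g 0 ≡ 0ℤ → g (suc n) ≡ 0ℤ →
                sumTo n g ≡ sumTo n (λ j → g (suc j))
sumTo-reindex n g g0≡0 gtop≡0 = begin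
    sumTo n g                           ≡⟨ ℤₚ.+-identityʳ (sumTo n g) ⟨
    sumTo n g ℤ.+ 0ℤ                    ≡⟨ cong (λ x → sumTo n g ℤ.+ x) gtop≡0 ⟨
    sumTo (suc n) g                     ≡⟨ sumTo-suc n g ⟩
    g 0 ℤ.+ sumTo n (λ j → g (suc j))   ≡⟨ cong (ℤ._+ sumTo n (λ j → g (suc j))) g0≡0 ⟩
    0ℤ ℤ.+ sumTo n (λ j → g (suc j))    ≡⟨ ℤₚ.+-identityˡ _ ⟩
    sumTo n (λ j → g (suc j))           ∎
  where
  open ≡-Reasoning

S-vanish : ∀ n k → n < k → S n k ≡ 0
S-vanish zero    (suc k) _         = refl
S-vanish (suc n) (suc k) (s≤s n<k) =
  cong₂ _+_ (trans (cong (suc k *_) (S-vanish n (suc k) (ℕₚ.m<n⇒m<1+n n<k))) (ℕₚ.*-zeroʳ (suc k)))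
            (S-vanish n k n<k)

+S-suc : ∀ n k → + S (suc n) (suc k) ≡ + suc k ℤ.* + S n (suc k) ℤ.+ + S n k
+S-suc n k = trans (ℤₚ.pos-+ (suc k * S n (suc k)) (S n k))
                   (cong (ℤ._+ + S n k) (ℤₚ.pos-* (suc k) (S n (suc k))))

stirling-sum-step : ∀ n (M : Seq) →
  sumTo n (λ j → + S n j ℤ.* (M (suc j) ℤ.+ + j ℤ.* M j))
    ≡ sumTo (suc n) (λ j → + S (suc n) j ℤ.* M j)
stirling-sum-step n M = begin
    sumTo n (λ j → + S n j ℤ.* (M (suc j) ℤ.+ + j ℤ.* M j))
  ≡⟨ sumTo-cong n (λ j → spread (+ S n j) (M (suc j)) (+ j) (M j)) ⟩
    sumTo n (λ j → + S n j ℤ.* M (suc j) ℤ.+ + j ℤ.* (+ S n j ℤ.* M j))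
  ≡⟨ sumTo-+ n _ _ ⟩
    sumTo n (λ j → + S n j ℤ.* M (suc j)) ℤ.+ sumTo n (λ j → + j ℤ.* (+ S n j ℤ.* M j))
  ≡⟨ cong (λ x → sumTo n (λ j → + S n j ℤ.* M (suc j)) ℤ.+ x)
          (sumTo-reindex n (λ j → + j ℤ.* (+ S n j ℤ.* M j)) refl top-vanishes) ⟩
    sumTo n (λ j → + S n j ℤ.* M (suc j))
      ℤ.+ sumTo n (λ j → + suc j ℤ.* (+ S n (suc j) ℤ.* M (suc j)))
  ≡⟨ sumTo-+ n _ _ ⟨
    sumTo n (λ j → + S n j ℤ.* M (suc j) ℤ.+ + suc j ℤ.* (+ S n (suc j) ℤ.* M (suc j)))
  ≡⟨ sumTo-cong n recurrence ⟩
    sumTo n (λ j → + S (suc n) (suc j) ℤ.* M (suc j))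
  ≡⟨ ℤₚ.+-identityˡ _ ⟨
    0ℤ ℤ.+ sumTo n (λ j → + S (suc n) (suc j) ℤ.* M (suc j))
  ≡⟨ sumTo-suc n (λ j → + S (suc n) j ℤ.* M j) ⟨
    sumTo (suc n) (λ j → + S (suc n) j ℤ.* M j) ∎
  where
  open ≡-Reasoning
  spread : ∀ s x j y → s ℤ.* (x ℤ.+ j ℤ.* y) ≡ s ℤ.* x ℤ.+ j ℤ.* (s ℤ.* y)
  spread = solve-∀
  collect : ∀ s x k s′ → s ℤ.* x ℤ.+ k ℤ.* (s′ ℤ.* x) ≡ (k ℤ.* s′ ℤ.+ s) ℤ.* x
  collect = solve-∀
  top-vanishes : + suc n ℤ.* (+ S n (suc n) ℤ.* M (suc n)) ≡ 0ℤ
  top-vanishes = trans (cong (λ s → + suc n ℤ.* (+ s ℤ.* M (suc n))) (S-vanish n (suc n) ℕₚ.≤-refl))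
                       (ℤₚ.*-zeroʳ (+ suc n))
  recurrence : ∀ j → + S n j ℤ.* M (suc j) ℤ.+ + suc j ℤ.* (+ S n (suc j) ℤ.* M (suc j))
                   ≡ + S (suc n) (suc j) ℤ.* M (suc j)
  recurrence j = trans (collect (+ S n j) (M (suc j)) (+ suc j) (+ S n (suc j)))
                       (cong (ℤ._* M (suc j)) (sym (+S-suc n j)))

-- moment g n k = φ(x^n · x(x−1)⋯(x−k+1)) for the functional φ with φ(x(x−1)⋯(x−j+1)) = g j;
-- the recurrence is x · x(x−1)⋯(x−k+1) = x(x−1)⋯(x−k) + k · x(x−1)⋯(x−k+1).
moment : Seq → ℕ → ℕ → ℤ
moment g zero    k = g k
moment g (suc n) k = moment g n (suc k) ℤ.+ + k ℤ.* moment g n k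

moment-falling : ∀ g k n → falling k (λ i → moment g i 0) n ≡ moment g n k
moment-falling g zero    n = refl
moment-falling g (suc k) n =
  trans (cong₂ (λ u v → u - + k ℤ.* v) (moment-falling g k (suc n)) (moment-falling g k n))
        (cancel (moment g n (suc k)) (+ k ℤ.* moment g n k))
  where
  cancel : ∀ x y → x ℤ.+ y - y ≡ x
  cancel = solve-∀

moment-periodic-mod : ∀ g K → (∀ k → g (k + K) ≡ g k mod K) →
                      ∀ n k → moment g n (k + K) ≡ moment g n k mod K
moment-periodic-mod g K periodic zero    k = periodic k
moment-periodic-mod g K periodic (suc n) k =
  mod-+ (moment-periodic-mod g K periodic n (suc k))
        (mod-* (+-multiple-mod k K) (moment-periodic-mod g K periodic n k))

moment-stirling : ∀ g n a → moment g (a + n) 0 ≡ sumTo n (λ j → + S n j ℤ.* moment g a j)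
moment-stirling g zero    a =
  trans (cong (λ i → moment g i 0) (ℕₚ.+-identityʳ a)) (sym (ℤₚ.*-identityˡ (moment g a 0)))
moment-stirling g (suc n) a = begin
    moment g (a + suc n) 0
  ≡⟨ cong (λ i → moment g i 0) (ℕₚ.+-suc a n) ⟩
    moment g (suc a + n) 0
  ≡⟨ moment-stirling g n (suc a) ⟩
    sumTo n (λ j → + S n j ℤ.* moment g (suc a) j)
  ≡⟨ stirling-sum-step n (moment g a) ⟩
    sumTo (suc n) (λ j → + S (suc n) j ℤ.* moment g a j) ∎
  where
  open ≡-Reasoning

f≡moment-sgn : ∀ n → f n ≡ moment sgn n 0
f≡moment-sgn n =
  sym (trans (moment-stirling sgn n 0) (sumTo-cong n (λ j → ℤₚ.*-comm (+ S n j) (sgn j))))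

sgn-periodic : ∀ t k → sgn (k + 2 * t) ≡ sgn k
sgn-periodic zero    k = cong sgn (ℕₚ.+-identityʳ k)
sgn-periodic (suc t) k = begin
    sgn (k + 2 * suc t)   ≡⟨ cong sgn (two-more k t) ⟩
    - - sgn (k + 2 * t)   ≡⟨ ℤₚ.neg-involutive _ ⟩
    sgn (k + 2 * t)       ≡⟨ sgn-periodic t k ⟩
    sgn k                 ∎
  where
  open ≡-Reasoning
  two-more : ∀ k t → k + 2 * suc t ≡ suc (suc (k + 2 * t))
  two-more = ℕ-solve-∀

4^n≡2^n*2^n : ∀ n → 4 ^ n ≡ 2 ^ n * 2 ^ n
4^n≡2^n*2^n n = begin
    4 ^ n           ≡⟨ ℕₚ.^-*-assoc 2 2 n ⟩
    2 ^ (2 * n)     ≡⟨ cong (λ e → 2 ^ (n + e)) (ℕₚ.+-identityʳ n) ⟩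
    2 ^ (n + n)     ≡⟨ ℕₚ.^-distribˡ-+-* 2 n n ⟩
    2 ^ n * 2 ^ n   ∎
  where
  open ≡-Reasoning

proposition2p3 : ∀ (n h : ℕ) → (+ (2 ^ suc h)) ∣ (f n - f (n + 3 * 4 ^ h))
proposition2p3 n h = Signed.∣⇒∣ᵤ (mod⇒∣ (begin
    f n                           ≡⟨ f≡moment-sgn n ⟩
    F n                           ≈⟨ period n ⟨
    F (n + 2 ^ h * (3 * 2 ^ h))   ≡⟨ cong (λ e → F (n + e)) shift ⟨
    F (n + 3 * 4 ^ h)             ≡⟨ f≡moment-sgn (n + 3 * 4 ^ h) ⟨
    f (n + 3 * 4 ^ h)             ∎))
  where
  open ≈-Reasoning (mod-setoid (2 ^ suc h))
  F : Seq
  F i = moment sgn i 0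
  fixed : falling (2 ^ suc h) F ≈ F mod 2 ^ suc h
  fixed i = mod-trans (≡⇒≡-mod (moment-falling sgn (2 ^ suc h) i))
                      (moment-periodic-mod sgn (2 ^ suc h) sgn-even i 0)
    where
    sgn-even : ∀ k → sgn (k + 2 ^ suc h) ≡ sgn k mod 2 ^ suc h
    sgn-even k = ≡⇒≡-mod (sgn-periodic (2 ^ h) k)
  period : ∀ i → F (i + 2 ^ h * (3 * 2 ^ h)) ≡ F i mod 2 ^ suc h
  period = falling-period-lift (2 ^ suc h) (3 * 2 ^ h) (falling-period-mod-2 h) h F fixed
  rearrange : ∀ x → 3 * (x * x) ≡ x * (3 * x)
  rearrange = ℕ-solve-∀
  shift : 3 * 4 ^ h ≡ 2 ^ h * (3 * 2 ^ h)
  shift = trans (cong (3 *_) (4^n≡2^n*2^n h)) (rearrange (2 ^ h))
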